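{- Let $m,p\ge0$ and let $Q$ be the Cartesian product of an $m$-dimensional simplex and a $p$-dimensional simplex. For every linear order on the vertex set of $Q$, the pulling triangulation of $Q$ (the polytopal complex of all faces of $Q$) with respect to this order is a flag simplicial complex.
   Context: Pulling triangulation (Hudson): for a polytopal complex $\mathcal{P}$ with a linear order $<$ on its vertex set, $\triangle(\mathcal{P})=\mathcal{P}$ if $\mathcal{P}$ is a single vertex; otherwise, with $v$ the least vertex, $\triangle(\mathcal{P})=\triangle(\mathcal{P}-v)\cup\bigcup_F\{\mathrm{conv}(\{v\}\cup G): G\in\triangle(\mathcal{P}(F))\}$, where $\mathcal{P}-v$ is the complex of faces not containing $v$, $\mathcal{P}(F)$ is the complex of faces contained in $F$, the union runs over the facets $F$ not containing $v$ of the maximal faces of $\mathcal{P}$ containing $v$, and orders are restricted. A simplicial complex is flag if every minimal nonface has exactly two elements. -}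

module Defs where

open import Level using (Level) renaming (suc to lsuc; zero to lzero)
open import Data.Nat using (ℕ; suc; _≤_; _+_)
open import Data.Fin using (Fin)
open import Data.Fin.Subset using (Subset; _∈_; _∉_; _⊆_; ⁅_⁆; _∪_; ∣_∣; Nonempty)
open import Data.Vec using (Vec; lookup; _[_]%=_; map)
open import Data.Nat.ListAction using (sum)
open import Data.Vec using (toList)
open import Data.Product using (Σ; ∃; _×_; _,_)
open import Relation.Binary.PropositionalEquality using (_≡_; _≢_)
open import Relation.Nullary using (¬_)
open import Function.Definitions using (Injective)

-- Product Q = Δ_m × Δ_p of an m-simplex (vertices Fin (suc m)) and a
-- p-simplex (vertices Fin (suc p)).  Vertex set of Q: Fin (suc m) × Fin (suc p).

Vtx : ℕ → ℕ → Set
Vtx m p = Fin (suc m) × Fin (suc p)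

-- A (finite, decidable) set of vertices of Q, stored row-wise:
-- (i , j) belongs to S iff j ∈ lookup S i.
VSet : ℕ → ℕ → Set
VSet m p = Vec (Subset (suc p)) (suc m)

-- Every face of Q is A × B with A ⊆ Fin (suc m), B ⊆ Fin (suc p) nonempty.
-- A pair (A , B) (possibly with an empty component) is a candidate face;
-- IsFace selects the actual (nonempty) faces of Q.
Face : ℕ → ℕ → Set
Face m p = Subset (suc m) × Subset (suc p)

Cx : ℕ → ℕ → Set₁
Cx m p = Face m p → Set

module _ {m p : ℕ} where

  _∈V_ : Vtx m p → VSet m p → Set
  (i , j) ∈V S = j ∈ lookup S i

  _⊆V_ : VSet m p → VSet m p → Set
  S ⊆V T = ∀ x → x ∈V S → x ∈V T

  cardV : VSet m p → ℕ
  cardV S = sum (toList (map ∣_∣ S))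

  insertV : Vtx m p → VSet m p → VSet m p
  insertV (i , j) G = G [ i ]%= (λ r → ⁅ j ⁆ ∪ r)

  singleV : Vtx m p → VSet m p
  singleV (i , j) = insertV (i , j) (Data.Vec.replicate _ (Data.Vec.replicate _ Data.Bool.false))
    where import Data.Bool

  IsFace : Face m p → Set
  IsFace (A , B) = Nonempty A × Nonempty B

  faceCx : Cx m p
  faceCx = IsFace

  _⊆F_ : Face m p → Face m p → Set
  (A , B) ⊆F (A' , B') = A ⊆ A' × B ⊆ B'

  _∈F_ : Vtx m p → Face m p → Set
  (i , j) ∈F (A , B) = i ∈ A × j ∈ B

  -- dimension of the face A × B is (|A| - 1) + (|B| - 1); we compare
  -- dim + 2 = |A| + |B| to avoid truncated subtraction.
  dim+2 : Face m p → ℕ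
  dim+2 (A , B) = ∣ A ∣ + ∣ B ∣

  IsFacetOf : Face m p → Face m p → Set
  IsFacetOf F M = IsFace F × F ⊆F M × suc (dim+2 F) ≡ dim+2 M

  vface : Vtx m p → Face m p
  vface (i , j) = ⁅ i ⁆ , ⁅ j ⁆

  IsVertexOf : Vtx m p → Cx m p → Set
  IsVertexOf v P = P (vface v)

  IsSingleVertex : Cx m p → Vtx m p → Set
  IsSingleVertex P v = ∀ G → (P G → G ≡ vface v) × (G ≡ vface v → P G)

  IsLeast : (Vtx m p → ℕ) → Cx m p → Vtx m p → Set
  IsLeast rank P v = IsVertexOf v P × (∀ w → IsVertexOf w P → rank v ≤ rank w)

  _─v_ : Cx m p → Vtx m p → Cx m p
  (P ─v v) G = P G × ¬ (v ∈F G)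

  subCx : Cx m p → Face m p → Cx m p
  subCx P F G = P G × G ⊆F F

  IsMaximal : Cx m p → Face m p → Set
  IsMaximal P M = P M × (∀ M' → P M' → M ⊆F M' → M' ⊆F M)

  -- Pulling triangulation (Hudson), with the linear order on vertices given by
  -- an injective rank function (restriction of the order is automatic).
  -- Pull rank P S  means: the simplex with vertex set S belongs to △(P).
  data Pull (rank : Vtx m p → ℕ) : Cx m p → VSet m p → Set₁ where
    base : ∀ {P v} → IsSingleVertex P v → Pull rank P (singleV v)
    rest : ∀ {P v S} → IsLeast rank P v → ¬ IsSingleVertex P v →
           Pull rank (P ─v v) S → Pull rank P S
    cone : ∀ {P v M F G} → IsLeast rank P v → ¬ IsSingleVertex P v →
           IsMaximal P M → v ∈F M → IsFacetOf F M → ¬ (v ∈F F) →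
           Pull rank (subCx P F) G → Pull rank P (insertV v G)

  IsTriFace : (Vtx m p → ℕ) → Cx m p → VSet m p → Set₁
  IsTriFace rank P T = ∃ λ S → Pull rank P S × T ⊆V S

  IsMinimalNonface : (VSet m p → Set₁) → VSet m p → Set₁
  IsMinimalNonface K T = ¬ K T × (∀ T' → T' ⊆V T → T' ≢ T → K T')

  IsFlag : (VSet m p → Set₁) → Set₁
  IsFlag K = ∀ T → IsMinimalNonface K T → cardV T ≡ 2

-- The simplices of the pulling triangulation of Δm × Δp are exactly the pairwise compatible
-- vertex sets, where two vertices are compatible when they share a row or a column, or when one
-- of them precedes both other corners of the rectangle they span.  A simplex is pairwise
-- compatible since in a cone step the pulled vertex is least in a face M containing all the
-- other vertices, so it precedes every vertex of M.  Conversely, a pairwise compatible set T is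
-- covered by a simplex, by induction on the dimension of the box M: if v is least in M, then
-- (T ∩ M) ∖ v lies in the facet of M missing the column of v when T meets the row of v
-- elsewhere in M, and in the facet missing the row of v otherwise.  Compatibility being a
-- condition on pairs, the triangulation is flag.
module Submission where

open import Defs
open import Data.Nat using (ℕ)
open import Function.Definitions using (Injective)
open import Relation.Binary.PropositionalEquality using (_≡_)

open import Data.Nat using (zero; suc; _+_; _≤_; _<_; _≤?_; _<?_)
open import Data.Nat.Properties using (≮⇒≥; ≤-antisym; suc-injective; +-suc; m+n≡0⇒m≡0)
open import Data.Nat.Induction using (<-wellFounded)
import Data.Bool.Properties as Bool
open import Data.Fin using (Fin; zero; suc)
open import Data.Fin.Properties using (any?) renaming (_≟_ to _≟ᶠ_)
open import Data.Fin.Subset using (Subset; _∈_; _∉_; _⊆_; ⁅_⁆; _∪_; ∣_∣; Nonempty; _-_; ⊥; ⊤; outside; inside)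
open import Data.Fin.Subset.Properties
  using (x∈⁅x⁆; x∈⁅y⁆⇒x≡y; p─⊥≡p; ∪-identityˡ; x∈p∪q⁺; x∈p∪q⁻; ∉⊥; _∈?_; ⊆-antisym; p─q⊆p;
         x∈p∧x≢y⇒x∈p-y; x∈p⇒∣p-x∣<∣p∣; nonempty?; ∈⊤; ∣⊥∣≡0)
open import Data.Vec using (Vec; _∷_; lookup; replicate; toList; map; updateAt; here; there)
import Data.Vec.Properties as Vec
open import Data.Nat.ListAction using (sum)
open import Data.Product using (∃; ∃₂; _×_; _,_; proj₁; proj₂)
import Data.Product.Properties as Product
open import Data.Sum using (_⊎_; inj₁; inj₂)
open import Data.Empty using (⊥-elim)
open import Function.Base using (_on_)
open import Induction.WellFounded using (Acc; acc)
open import Relation.Binary.Construct.On using () renaming (wellFounded to on-wellFounded)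
open import Relation.Nullary using (¬_; Dec; yes; no)
open import Relation.Nullary.Decidable using (map′; _×-dec_; _⊎-dec_; ¬?)
open import Relation.Unary using (Decidable)
open import Relation.Binary.PropositionalEquality using (refl; sym; trans; cong; cong₂; subst; _≢_; module ≡-Reasoning)

x∉p-x : ∀ {n} (x : Fin n) (p : Subset n) → x ∉ p - x
x∉p-x zero    (_ ∷ p) ()
x∉p-x (suc x) (_ ∷ p) (there x∈p-x) = x∉p-x x p x∈p-x

x∈p⇒suc∣p-x∣≡∣p∣ : ∀ {n} {x : Fin n} {p} → x ∈ p → suc ∣ p - x ∣ ≡ ∣ p ∣
x∈p⇒suc∣p-x∣≡∣p∣ {x = zero}  {inside  ∷ p} here        = cong (λ q → suc ∣ q ∣) (p─⊥≡p p)
x∈p⇒suc∣p-x∣≡∣p∣ {x = suc x} {inside  ∷ p} (there x∈p) = cong suc (x∈p⇒suc∣p-x∣≡∣p∣ x∈p)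
x∈p⇒suc∣p-x∣≡∣p∣ {x = suc x} {outside ∷ p} (there x∈p) = x∈p⇒suc∣p-x∣≡∣p∣ x∈p

x∉p⇒∣⁅x⁆∪p∣≡suc∣p∣ : ∀ {n} {x : Fin n} {p} → x ∉ p → ∣ ⁅ x ⁆ ∪ p ∣ ≡ suc ∣ p ∣
x∉p⇒∣⁅x⁆∪p∣≡suc∣p∣ {x = zero}  {inside  ∷ p} x∉p = ⊥-elim (x∉p here)
x∉p⇒∣⁅x⁆∪p∣≡suc∣p∣ {x = zero}  {outside ∷ p} x∉p = cong (λ q → suc ∣ q ∣) (∪-identityˡ p)
x∉p⇒∣⁅x⁆∪p∣≡suc∣p∣ {x = suc x} {inside  ∷ p} x∉p = cong suc (x∉p⇒∣⁅x⁆∪p∣≡suc∣p∣ (λ x∈p → x∉p (there x∈p)))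
x∉p⇒∣⁅x⁆∪p∣≡suc∣p∣ {x = suc x} {outside ∷ p} x∉p = x∉p⇒∣⁅x⁆∪p∣≡suc∣p∣ (λ x∈p → x∉p (there x∈p))

x∈p⇒⁅x⁆⊆p : ∀ {n} {x : Fin n} {p} → x ∈ p → ⁅ x ⁆ ⊆ p
x∈p⇒⁅x⁆⊆p {p = p} x∈p y∈⁅x⁆ = subst (_∈ p) (sym (x∈⁅y⁆⇒x≡y _ y∈⁅x⁆)) x∈p

Empty[p-y]⇒p⊆⁅y⁆ : ∀ {n} {y : Fin n} {p} → ¬ Nonempty (p - y) → p ⊆ ⁅ y ⁆
Empty[p-y]⇒p⊆⁅y⁆ {y = y} p-y≡∅ {x} x∈p with x ≟ᶠ y
... | yes refl = x∈⁅x⁆ y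
... | no  x≢y  = ⊥-elim (p-y≡∅ (x , x∈p∧x≢y⇒x∈p-y x∈p x≢y))

Nonempty∧p⊆⁅y⁆⇒p≡⁅y⁆ : ∀ {n} {y : Fin n} {p} → Nonempty p → p ⊆ ⁅ y ⁆ → p ≡ ⁅ y ⁆
Nonempty∧p⊆⁅y⁆⇒p≡⁅y⁆ {y = y} {p} (x , x∈p) p⊆⁅y⁆ = ⊆-antisym p⊆⁅y⁆ ⁅y⁆⊆p
  where
  ⁅y⁆⊆p : ⁅ y ⁆ ⊆ p
  ⁅y⁆⊆p = x∈p⇒⁅x⁆⊆p (subst (_∈ p) (x∈⁅y⁆⇒x≡y y (p⊆⁅y⁆ x∈p)) x∈p)

totalCard : ∀ {n k} → Vec (Subset k) n → ℕ
totalCard S = sum (toList (map ∣_∣ S))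

totalCard-insert : ∀ {n k} (S : Vec (Subset k) n) i {j} → j ∉ lookup S i →
                   totalCard (updateAt S i (⁅ j ⁆ ∪_)) ≡ suc (totalCard S)
totalCard-insert (r ∷ S) zero    j∉r = cong (_+ totalCard S) (x∉p⇒∣⁅x⁆∪p∣≡suc∣p∣ j∉r)
totalCard-insert (r ∷ S) (suc i) j∉S = trans (cong (∣ r ∣ +_) (totalCard-insert S i j∉S)) (+-suc ∣ r ∣ (totalCard S))

totalCard-⊥ : ∀ n k → totalCard (replicate n (⊥ {k})) ≡ 0
totalCard-⊥ zero    k = refl
totalCard-⊥ (suc n) k = cong₂ _+_ (∣⊥∣≡0 k) (totalCard-⊥ n k)

module _ {m p : ℕ} where

  ∅V : VSet m p
  ∅V = replicate _ ⊥

  pairV : Vtx m p → Vtx m p → VSet m p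
  pairV x y = insertV x (singleV y)

  _≟V_ : (x y : Vtx m p) → Dec (x ≡ y)
  _≟V_ = Product.≡-dec _≟ᶠ_ _≟ᶠ_

  _∈V?_ : (x : Vtx m p) (S : VSet m p) → Dec (x ∈V S)
  (i , j) ∈V? S = j ∈? lookup S i

  _≟VSet_ : (S T : VSet m p) → Dec (S ≡ T)
  _≟VSet_ = Vec.≡-dec (Vec.≡-dec Bool._≟_)

  ∃V? : {Q : Vtx m p → Set} → Decidable Q → Dec (∃ Q)
  ∃V? Q? = map′ (λ { (i , j , q) → (i , j) , q }) (λ { ((i , j) , q) → i , j , q })
                (any? (λ i → any? (λ j → Q? (i , j))))

  ∉∅V : ∀ (x : Vtx m p) → ¬ (x ∈V ∅V)
  ∉∅V (i , j) j∈∅ = ∉⊥ (subst (j ∈_) (Vec.lookup-replicate i ⊥) j∈∅)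

  v∈insertV : ∀ (v : Vtx m p) G → v ∈V insertV v G
  v∈insertV (i , j) G = subst (j ∈_) (sym (Vec.lookup∘updateAt i G)) (x∈p∪q⁺ (inj₁ (x∈⁅x⁆ j)))

  ∈insertV⁺ : ∀ v G {x : Vtx m p} → x ∈V G → x ∈V insertV v G
  ∈insertV⁺ (i , j) G {k , l} x∈G with k ≟ᶠ i
  ... | yes refl = subst (l ∈_) (sym (Vec.lookup∘updateAt i G)) (x∈p∪q⁺ (inj₂ x∈G))
  ... | no  k≢i  = subst (l ∈_) (sym (Vec.lookup∘updateAt′ k i k≢i G)) x∈G

  ∈insertV⁻ : ∀ v G {x : Vtx m p} → x ∈V insertV v G → x ≡ v ⊎ x ∈V G
  ∈insertV⁻ (i , j) G {k , l} x∈ with k ≟ᶠ i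
  ... | no  k≢i  = inj₂ (subst (l ∈_) (Vec.lookup∘updateAt′ k i k≢i G) x∈)
  ... | yes refl with x∈p∪q⁻ ⁅ j ⁆ (lookup G i) (subst (l ∈_) (Vec.lookup∘updateAt i G) x∈)
  ...   | inj₁ l∈⁅j⁆ = inj₁ (cong (i ,_) (x∈⁅y⁆⇒x≡y j l∈⁅j⁆))
  ...   | inj₂ l∈G   = inj₂ l∈G

  ∈singleV⁻ : ∀ v {x : Vtx m p} → x ∈V singleV v → x ≡ v
  ∈singleV⁻ v {x} x∈ with ∈insertV⁻ v ∅V x∈
  ... | inj₁ x≡v = x≡v
  ... | inj₂ x∈∅ = ⊥-elim (∉∅V x x∈∅)

  x∈pairV : ∀ (x y : Vtx m p) → x ∈V pairV x y
  x∈pairV x y = v∈insertV x (singleV y)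

  y∈pairV : ∀ (x y : Vtx m p) → y ∈V pairV x y
  y∈pairV x y = ∈insertV⁺ x (singleV y) (v∈insertV y ∅V)

  pairV⊆ : ∀ (T : VSet m p) x y → x ∈V T → y ∈V T → pairV x y ⊆V T
  pairV⊆ T x y x∈T y∈T z z∈ with ∈insertV⁻ x (singleV y) z∈
  ... | inj₁ z≡x = subst (_∈V T) (sym z≡x) x∈T
  ... | inj₂ z∈y = subst (_∈V T) (sym (∈singleV⁻ y z∈y)) y∈T

  cardV-insertV : ∀ (v : Vtx m p) G → ¬ (v ∈V G) → cardV (insertV v G) ≡ suc (cardV G)
  cardV-insertV (i , j) G v∉G = totalCard-insert G i v∉G

  cardV-pairV : ∀ (x y : Vtx m p) → x ≢ y → cardV (pairV x y) ≡ 2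
  cardV-pairV x y x≢y = begin
    cardV (pairV x y)        ≡⟨ cardV-insertV x (singleV y) (λ x∈y → x≢y (∈singleV⁻ y x∈y)) ⟩
    suc (cardV (singleV y))  ≡⟨ cong suc (cardV-insertV y ∅V (∉∅V y)) ⟩
    suc (suc (cardV ∅V))     ≡⟨ cong (λ k → suc (suc k)) (totalCard-⊥ (suc m) (suc p)) ⟩
    2                        ∎
    where open ≡-Reasoning

module _ {m p : ℕ} where

  ⊆F-trans : ∀ {G H K : Face m p} → G ⊆F H → H ⊆F K → G ⊆F K
  ⊆F-trans (A⊆ , B⊆) (A⊆′ , B⊆′) = (λ h → A⊆′ (A⊆ h)) , (λ h → B⊆′ (B⊆ h))

  ∈F-mono : ∀ {G H : Face m p} {x : Vtx m p} → G ⊆F H → x ∈F G → x ∈F H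
  ∈F-mono (A⊆ , B⊆) (i∈ , j∈) = A⊆ i∈ , B⊆ j∈

  x∈vface : (x : Vtx m p) → x ∈F vface x
  x∈vface (i , j) = x∈⁅x⁆ i , x∈⁅x⁆ j

  ∈F⇒vface⊆F : ∀ {x : Vtx m p} {G : Face m p} → x ∈F G → vface x ⊆F G
  ∈F⇒vface⊆F (i∈ , j∈) = x∈p⇒⁅x⁆⊆p i∈ , x∈p⇒⁅x⁆⊆p j∈

  vface⊆F⇒∈F : ∀ {x : Vtx m p} {G : Face m p} → vface x ⊆F G → x ∈F G
  vface⊆F⇒∈F {x} vx⊆G = ∈F-mono vx⊆G (x∈vface x)

  vface-isFace : (x : Vtx m p) → IsFace (vface x)
  vface-isFace (i , j) = (i , x∈⁅x⁆ i) , (j , x∈⁅x⁆ j)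

  _∈F?_ : (x : Vtx m p) (G : Face m p) → Dec (x ∈F G)
  (i , j) ∈F? (A , B) = (i ∈? A) ×-dec (j ∈? B)

  DownClosed : Cx m p → Set
  DownClosed P = ∀ G H → P G → IsFace H → H ⊆F G → P H

  ─v-downClosed : ∀ {P : Cx m p} v → DownClosed P → DownClosed (P ─v v)
  ─v-downClosed v dc G H (PG , v∉G) H-face H⊆G = dc G H PG H-face H⊆G , λ v∈H → v∉G (∈F-mono H⊆G v∈H)

  subCx-downClosed : ∀ {P : Cx m p} F → DownClosed P → DownClosed (subCx P F)
  subCx-downClosed F dc G H (PG , G⊆F) H-face H⊆G = dc G H PG H-face H⊆G , ⊆F-trans {H} {G} {F} H⊆G G⊆F

  faceCx-downClosed : DownClosed faceCx
  faceCx-downClosed _ _ _ H-face _ = H-face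

  dropRow-isFacet : ∀ {A : Subset (suc m)} {B : Subset (suc p)} {a} →
                    a ∈ A → Nonempty (A - a) → Nonempty B → IsFacetOf (A - a , B) (A , B)
  dropRow-isFacet {A} {B} {a} a∈A neA-a neB =
    (neA-a , neB) , (p─q⊆p A ⁅ a ⁆ , (λ h → h)) , cong (_+ ∣ B ∣) (x∈p⇒suc∣p-x∣≡∣p∣ a∈A)

  dropColumn-isFacet : ∀ {A : Subset (suc m)} {B : Subset (suc p)} {b} →
                       b ∈ B → Nonempty A → Nonempty (B - b) → IsFacetOf (A , B - b) (A , B)
  dropColumn-isFacet {A} {B} {b} b∈B neA neB-b =
    (neA , neB-b) , ((λ h → h) , p─q⊆p B ⁅ b ⁆) ,
    trans (sym (+-suc ∣ A ∣ ∣ B - b ∣)) (cong (∣ A ∣ +_) (x∈p⇒suc∣p-x∣≡∣p∣ b∈B))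

  IsFaceCxOf : Cx m p → Face m p → Set
  IsFaceCxOf P M = (∀ G → P G → IsFace G × G ⊆F M) × (∀ G → IsFace G → G ⊆F M → P G)

  faceCx-isFaceCxOf-⊤ : IsFaceCxOf faceCx (⊤ , ⊤)
  faceCx-isFaceCxOf-⊤ = (λ G G-face → G-face , (λ _ → ∈⊤) , (λ _ → ∈⊤)) , (λ G G-face _ → G-face)

  subCx-isFaceCxOf : ∀ {P : Cx m p} {M F} → IsFaceCxOf P M → F ⊆F M → IsFaceCxOf (subCx P F) F
  subCx-isFaceCxOf {M = M} {F} (P⊆M , M⊆P) F⊆M =
    (λ G (PG , G⊆F) → proj₁ (P⊆M G PG) , G⊆F) ,
    (λ G G-face G⊆F → M⊆P G G-face (⊆F-trans {G} {F} {M} G⊆F F⊆M) , G⊆F)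

  isFaceCxOf-maximal : ∀ {P : Cx m p} {M} → IsFace M → IsFaceCxOf P M → IsMaximal P M
  isFaceCxOf-maximal M-face (P⊆M , M⊆P) =
    M⊆P _ M-face ((λ h → h) , (λ h → h)) , λ M′ PM′ _ → proj₂ (P⊆M M′ PM′)

  isFaceCxOf-single : ∀ {P : Cx m p} {A B a b} → IsFaceCxOf P (A , B) → P (vface (a , b)) →
                      A ⊆ ⁅ a ⁆ → B ⊆ ⁅ b ⁆ → IsSingleVertex P (a , b)
  isFaceCxOf-single {P} {a = a} {b} (P⊆M , _) Pv A⊆a B⊆b G = G≡v , λ { refl → Pv }
    where
    G≡v : P G → G ≡ vface (a , b)
    G≡v PG with P⊆M G PG
    ... | (neA′ , neB′) , (A′⊆A , B′⊆B) =
      cong₂ _,_ (Nonempty∧p⊆⁅y⁆⇒p≡⁅y⁆ neA′ (λ h → A⊆a (A′⊆A h)))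
                (Nonempty∧p⊆⁅y⁆⇒p≡⁅y⁆ neB′ (λ h → B⊆b (B′⊆B h)))

  face-avoiding-v⇒¬single : ∀ {P : Cx m p} {F v} → P F → ¬ (v ∈F F) → ¬ IsSingleVertex P v
  face-avoiding-v⇒¬single {v = v} PF v∉F single =
    v∉F (subst (v ∈F_) (sym (proj₁ (single _) PF)) (x∈vface v))

module _ {m p : ℕ} (rank : Vtx m p → ℕ) where

  PrecedesCorners : Vtx m p → Vtx m p → Set
  PrecedesCorners (i , j) (k , l) = rank (i , j) ≤ rank (i , l) × rank (i , j) ≤ rank (k , j)

  Compatible : Vtx m p → Vtx m p → Set
  Compatible (i , j) (k , l) =
    i ≡ k ⊎ j ≡ l ⊎ PrecedesCorners (i , j) (k , l) ⊎ PrecedesCorners (k , l) (i , j)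

  compatible? : ∀ x y → Dec (Compatible x y)
  compatible? (i , j) (k , l) = (i ≟ᶠ k) ⊎-dec (j ≟ᶠ l) ⊎-dec precedes? (i , j) (k , l) ⊎-dec precedes? (k , l) (i , j)
    where
    precedes? : ∀ x y → Dec (PrecedesCorners x y)
    precedes? (i , j) (k , l) = (rank (i , j) ≤? rank (i , l)) ×-dec (rank (i , j) ≤? rank (k , j))

  PairwiseCompatible : VSet m p → Set
  PairwiseCompatible S = ∀ x y → x ∈V S → y ∈V S → Compatible x y

  pairwiseCompatible⊎conflict : ∀ T → PairwiseCompatible T ⊎ ∃₂ λ x y → x ∈V T × y ∈V T × ¬ Compatible x y
  pairwiseCompatible⊎conflict T with ∃V? (λ x → ∃V? (λ y → x ∈V? T ×-dec y ∈V? T ×-dec ¬? (compatible? x y)))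
  ... | yes (x , y , conflict) = inj₂ (x , y , conflict)
  ... | no  ¬conflict          = inj₁ compatible
    where
    compatible : PairwiseCompatible T
    compatible x y x∈T y∈T with compatible? x y
    ... | yes x∼y = x∼y
    ... | no  x≁y = ⊥-elim (¬conflict (x , y , x∈T , y∈T , x≁y))

  -- Every simplex of the pulling triangulation is pairwise compatible

  Pull-vertex : ∀ {P S} → Pull rank P S → ∀ {x} → x ∈V S → P (vface x)
  Pull-vertex (base {P} {v} single) x∈ =
    subst (λ x → P (vface x)) (sym (∈singleV⁻ v x∈)) (proj₂ (single (vface v)) refl)
  Pull-vertex (rest _ _ pull) x∈ = proj₁ (Pull-vertex pull x∈)
  Pull-vertex (cone {v = v} {G = G} least _ _ _ _ _ pull) {x} x∈ with ∈insertV⁻ v G x∈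
  ... | inj₁ refl = proj₁ least
  ... | inj₂ x∈G  = proj₁ (Pull-vertex pull x∈G)

  least-precedesCorners : ∀ {P v M} → DownClosed P → IsLeast rank P v → P M → v ∈F M →
                          ∀ {y} → y ∈F M → PrecedesCorners v y
  least-precedesCorners {P} {a , b} {M} dc (_ , least) PM (a∈ , b∈) {k , l} (k∈ , l∈) =
    least (a , l) (corner a∈ l∈) , least (k , b) (corner k∈ b∈)
    where
    corner : ∀ {i j} → i ∈ proj₁ M → j ∈ proj₂ M → P (vface (i , j))
    corner i∈ j∈ = dc M _ PM (vface-isFace _) (∈F⇒vface⊆F (i∈ , j∈))

  apex-precedesCorners : ∀ {P v M F G} → DownClosed P → IsLeast rank P v → P M → v ∈F M → F ⊆F M →
                         Pull rank (subCx P F) G → ∀ {y} → y ∈V G → PrecedesCorners v y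
  apex-precedesCorners dc least PM v∈M F⊆M pull y∈G =
    least-precedesCorners dc least PM v∈M (∈F-mono F⊆M (vface⊆F⇒∈F (proj₂ (Pull-vertex pull y∈G))))

  Pull-pairwiseCompatible : ∀ {P S} → DownClosed P → Pull rank P S → PairwiseCompatible S
  Pull-pairwiseCompatible dc (base {v = v} _) x y x∈ y∈
    rewrite ∈singleV⁻ v x∈ | ∈singleV⁻ v y∈ = inj₁ refl
  Pull-pairwiseCompatible dc (rest {v = v} _ _ pull) = Pull-pairwiseCompatible (─v-downClosed v dc) pull
  Pull-pairwiseCompatible dc (cone {v = v} {F = F} {G} least _ (PM , _) v∈M (_ , F⊆M , _) _ pull) x y x∈ y∈
    with ∈insertV⁻ v G x∈ | ∈insertV⁻ v G y∈
  ... | inj₁ refl | inj₁ refl = inj₁ refl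
  ... | inj₁ refl | inj₂ y∈G  = inj₂ (inj₂ (inj₁ (apex-precedesCorners dc least PM v∈M F⊆M pull y∈G)))
  ... | inj₂ x∈G  | inj₁ refl = inj₂ (inj₂ (inj₂ (apex-precedesCorners dc least PM v∈M F⊆M pull x∈G)))
  ... | inj₂ x∈G  | inj₂ y∈G  = Pull-pairwiseCompatible (subCx-downClosed F dc) pull x y x∈G y∈G

  triFace-pairwiseCompatible : ∀ {P} → DownClosed P → ∀ T → IsTriFace rank P T → PairwiseCompatible T
  triFace-pairwiseCompatible dc T (S , pull , T⊆S) x y x∈ y∈ =
    Pull-pairwiseCompatible dc pull x y (T⊆S x x∈) (T⊆S y y∈)

  -- Every pairwise compatible vertex set lies in a simplex of the pulling triangulation

  isFaceCxOf-least : ∀ {P M v} → IsFaceCxOf P M → v ∈F M → (∀ w → w ∈F M → rank v ≤ rank w) → IsLeast rank P v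
  isFaceCxOf-least (P⊆M , M⊆P) v∈M v-least =
    M⊆P _ (vface-isFace _) (∈F⇒vface⊆F v∈M) , λ w Pw → v-least w (vface⊆F⇒∈F (proj₂ (P⊆M _ Pw)))

  leastVertex : ∀ {Q : Vtx m p → Set} → Decidable Q → ∀ {x} → Q x →
                ∃ λ v → Q v × (∀ w → Q w → rank v ≤ rank w)
  leastVertex {Q} Q? {x} Qx = descend x (on-wellFounded rank <-wellFounded x) Qx
    where
    descend : ∀ x → Acc (_<_ on rank) x → Q x → ∃ λ v → Q v × (∀ w → Q w → rank v ≤ rank w)
    descend x (acc smaller) Qx with ∃V? (λ y → Q? y ×-dec rank y <? rank x)
    ... | yes (y , Qy , y<x) = descend y (smaller y<x) Qy
    ... | no  ¬below         = x , Qx , λ w Qw → ≮⇒≥ (λ w<x → ¬below (w , Qw , w<x))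

  module Completeness (rank-injective : Injective _≡_ _≡_ rank)
                      (T : VSet m p) (compatible : PairwiseCompatible T) where

    CoveredBy : Face m p → VSet m p → Set
    CoveredBy M S = ∀ x → x ∈V T → x ∈F M → x ∈V S

    Covered : Cx m p → Face m p → Set₁
    Covered P M = ∃ λ S → Pull rank P S × CoveredBy M S

    CoverableAt : ℕ → Set₁
    CoverableAt n = ∀ {P M} → IsFace M → dim+2 M ≡ n → IsFaceCxOf P M → Covered P M

    CoveringFacet : Face m p → Vtx m p → Set
    CoveringFacet M v = ∃ λ F → IsFacetOf F M × ¬ (v ∈F F) × (∀ x → x ∈V T → x ∈F M → x ≢ v → x ∈F F)

    module LeastInBox {A : Subset (suc m)} {B : Subset (suc p)} {a : Fin (suc m)} {b : Fin (suc p)}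
                      (v∈M : (a , b) ∈F (A , B)) (v-least : ∀ w → w ∈F (A , B) → rank (a , b) ≤ rank w) where

      least-unique : ∀ {w} → w ∈F (A , B) → rank w ≤ rank (a , b) → w ≡ (a , b)
      least-unique {w} w∈M w≤v = rank-injective (≤-antisym w≤v (v-least w w∈M))

      RowMate : Set
      RowMate = ∃ λ j → (a , j) ∈V T × j ∈ B × j ≢ b

      rowMate? : Dec RowMate
      rowMate? = any? (λ j → ((a , j) ∈V? T) ×-dec (j ∈? B) ×-dec ¬? (j ≟ᶠ b))

      -- v = (a , b) is a corner of the rectangle spanned by (a , j) and (i , b), and it is least in M.
      rowMate⇒offColumn : RowMate → ∀ {i l} → (i , l) ∈V T → (i , l) ∈F (A , B) → (i , l) ≢ (a , b) → l ≢ b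
      rowMate⇒offColumn (j , aj∈T , j∈B , j≢b) {i} x∈T (i∈A , _) x≢v refl
        with compatible (a , j) (i , b) aj∈T x∈T
      ... | inj₁ refl                      = x≢v refl
      ... | inj₂ (inj₁ j≡b)                = j≢b j≡b
      ... | inj₂ (inj₂ (inj₁ (aj≤v , _))) = j≢b (cong proj₂ (least-unique (proj₁ v∈M , j∈B) aj≤v))
      ... | inj₂ (inj₂ (inj₂ (_ , x≤v)))  = x≢v (least-unique (i∈A , proj₂ v∈M) x≤v)

      ¬rowMate⇒offRow : ¬ RowMate → ∀ {i l} → (i , l) ∈V T → (i , l) ∈F (A , B) → (i , l) ≢ (a , b) → i ≢ a
      ¬rowMate⇒offRow ¬mate {l = l} x∈T (_ , l∈B) x≢v refl with l ≟ᶠ b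
      ... | yes refl = x≢v refl
      ... | no  l≢b  = ¬mate (l , x∈T , l∈B , l≢b)

      v∉dropRow : ¬ ((a , b) ∈F (A - a , B))
      v∉dropRow (a∈A-a , _) = x∉p-x a A a∈A-a

      v∉dropColumn : ¬ ((a , b) ∈F (A , B - b))
      v∉dropColumn (_ , b∈B-b) = x∉p-x b B b∈B-b

      coveringFacet : (A ⊆ ⁅ a ⁆ × B ⊆ ⁅ b ⁆) ⊎ CoveringFacet (A , B) (a , b)
      coveringFacet with rowMate?
      ... | yes mate@(j , _ , j∈B , j≢b) =
        inj₂ ((A , B - b) , dropColumn-isFacet (proj₂ v∈M) (a , proj₁ v∈M) (j , x∈p∧x≢y⇒x∈p-y j∈B j≢b) ,
              v∉dropColumn , λ { (i , l) x∈T (i∈A , l∈B) x≢v →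
                i∈A , x∈p∧x≢y⇒x∈p-y l∈B (rowMate⇒offColumn mate x∈T (i∈A , l∈B) x≢v) })
      ... | no ¬mate with nonempty? (A - a) | nonempty? (B - b)
      ...   | yes neA-a | _ =
        inj₂ ((A - a , B) , dropRow-isFacet (proj₁ v∈M) neA-a (b , proj₂ v∈M) ,
              v∉dropRow , λ { (i , l) x∈T (i∈A , l∈B) x≢v →
                x∈p∧x≢y⇒x∈p-y i∈A (¬rowMate⇒offRow ¬mate x∈T (i∈A , l∈B) x≢v) , l∈B })
      ...   | no A-a≡∅ | yes neB-b =
        inj₂ ((A , B - b) , dropColumn-isFacet (proj₂ v∈M) (a , proj₁ v∈M) neB-b ,
              v∉dropColumn , λ { (i , l) x∈T x∈M x≢v →
                ⊥-elim (¬rowMate⇒offRow ¬mate x∈T x∈M x≢v (x∈⁅y⁆⇒x≡y a (Empty[p-y]⇒p⊆⁅y⁆ A-a≡∅ (proj₁ x∈M)))) })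
      ...   | no A-a≡∅ | no B-b≡∅ = inj₁ (Empty[p-y]⇒p⊆⁅y⁆ A-a≡∅ , Empty[p-y]⇒p⊆⁅y⁆ B-b≡∅)

      covered : ∀ {n P} → CoverableAt n → IsFaceCxOf P (A , B) → dim+2 (A , B) ≡ suc n → Covered P (A , B)
      covered IH PM size with coveringFacet
      ... | inj₁ (A⊆a , B⊆b) =
        singleV (a , b) , base (isFaceCxOf-single PM (proj₁ (isFaceCxOf-least PM v∈M v-least)) A⊆a B⊆b) , only-v
        where
        only-v : CoveredBy (A , B) (singleV (a , b))
        only-v (i , l) _ (i∈A , l∈B) =
          subst (_∈V singleV (a , b)) (sym (cong₂ _,_ (x∈⁅y⁆⇒x≡y a (A⊆a i∈A)) (x∈⁅y⁆⇒x≡y b (B⊆b l∈B))))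
                (v∈insertV (a , b) ∅V)
      ... | inj₂ (F , F-facet@(F-face , F⊆M , F-size) , v∉F , T∩M-v⊆F)
        with IH F-face (suc-injective (trans F-size size)) (subCx-isFaceCxOf PM F⊆M)
      ...   | S , pull , covered-by-S =
        insertV (a , b) S ,
        cone (isFaceCxOf-least PM v∈M v-least) (face-avoiding-v⇒¬single (proj₂ PM F F-face F⊆M) v∉F)
             (isFaceCxOf-maximal ((a , proj₁ v∈M) , (b , proj₂ v∈M)) PM) v∈M F-facet v∉F pull ,
        covered-by-v∪S
        where
        covered-by-v∪S : CoveredBy (A , B) (insertV (a , b) S)
        covered-by-v∪S x x∈T x∈M with x ≟V (a , b)
        ... | yes refl = v∈insertV (a , b) S
        ... | no  x≢v  = ∈insertV⁺ (a , b) S (covered-by-S x x∈T (T∩M-v⊆F x x∈T x∈M x≢v))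

    coverable : ∀ n → CoverableAt n
    coverable zero {M = A , B} ((a , a∈A) , _) size≡0 _
      with subst (∣ A - a ∣ <_) (m+n≡0⇒m≡0 ∣ A ∣ size≡0) (x∈p⇒∣p-x∣<∣p∣ a∈A)
    ... | ()
    coverable (suc n) {M = A , B} ((a₀ , a₀∈A) , (b₀ , b₀∈B)) size PM
      with leastVertex (λ x → x ∈F? (A , B)) (a₀∈A , b₀∈B)
    ... | _ , v∈M , v-least = LeastInBox.covered v∈M v-least (coverable n) PM size

  pairwiseCompatible⇒triFace : Injective _≡_ _≡_ rank → ∀ T → PairwiseCompatible T → IsTriFace rank faceCx T
  pairwiseCompatible⇒triFace rank-injective T compatible =
    let S , pull , covered = coverable _ ((zero , ∈⊤) , (zero , ∈⊤)) refl faceCx-isFaceCxOf-⊤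
    in  S , pull , λ x x∈T → covered x x∈T (∈⊤ , ∈⊤)
    where open Completeness rank-injective T compatible

corollary3p4 : (m p : ℕ) (rank : Vtx m p → ℕ) → Injective _≡_ _≡_ rank →
    IsFlag (IsTriFace rank (faceCx {m} {p}))
corollary3p4 m p rank rank-injective T (T∉△ , proper⊆T∈△) with pairwiseCompatible⊎conflict rank T
... | inj₁ compatible = ⊥-elim (T∉△ (pairwiseCompatible⇒triFace rank rank-injective T compatible))
... | inj₂ (x , y , x∈T , y∈T , x≁y) with pairV x y ≟VSet T
...   | yes xy≡T = trans (cong cardV (sym xy≡T)) (cardV-pairV x y (λ { refl → x≁y (inj₁ refl) }))
...   | no  xy≢T =
  ⊥-elim (x≁y (triFace-pairwiseCompatible rank faceCx-downClosed (pairV x y) xy∈△ x y (x∈pairV x y) (y∈pairV x y)))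
  where
  xy∈△ : IsTriFace rank faceCx (pairV x y)
  xy∈△ = proper⊆T∈△ (pairV x y) (pairV⊆ T x y x∈T y∈T) xy≢T
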